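{- Let $m,n$ be positive integers with $\gcd(m,n)=d$, let ${\sf p}\in\mathcal{PW}_m^n$, and let $\mathbf{x}\in\mathrm{Fix}({\sf p})$. Then the multiset of coordinates $\{x_i\}_{i=0}^{m-1}$ can be partitioned into disjoint multisets, each of size $m/d$ and of the form $\{a+kd+b_km\}_{k=0}^{m/d-1}$ for some real number $a$ and integers $b_k$.
   Context: $[m]=\{0,\ldots,m-1\}$; $\mathcal{PW}_m^n$ is the set of ${\sf p}={\sf p}_0\cdots{\sf p}_{n-1}\in[m]^n$ with $|\{j:{\sf p}_j<i\}|\ge in/m$ for $1\le i\le m$. $V^m=\{\mathbf{x}\in\mathbb{R}^m:\sum_ix_i=0,\ x_0\le\cdots\le x_{m-1}\}$. A letter $i$ acts on $\mathbf{x}\in V^m$ by $\mathrm{sort}(\mathbf{x}+m\mathbf{e}_i-\mathbb{1}_m)$ (add $m$ to $x_i$, subtract $1$ from all coordinates, sort increasingly); words act letter by letter from left to right. $\mathrm{Fix}({\sf w})=\{\mathbf{x}\in V^m:{\sf w}(\mathbf{x})=\mathbf{x}\}$. -}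

module Defs where

open import Level using (0ℓ)
open import Data.Nat as ℕ using (ℕ; zero; suc)
open import Data.Integer as ℤ using (ℤ; +_; -[1+_])
open import Data.Fin using (Fin; toℕ; _≟_)
open import Data.Fin.Permutation using (Permutation′; _⟨$⟩ʳ_)
open import Data.Vec using (Vec; []; _∷_)
open import Data.List using (List; length; filter; foldr; map)
open import Data.List.Base using (allFin)
open import Data.Product using (Σ; ∃; _×_)
open import Relation.Nullary using (¬_; yes; no)
open import Relation.Binary.PropositionalEquality using (_≡_)
open import Relation.Binary.Structures using (IsTotalOrder)
import Algebra.Structures as AS

-- The real numbers, axiomatised as a (Dedekind-)complete ordered field.
-- Any model is isomorphic to ℝ; the theorem is stated for every model.

record CompleteOrderedField : Set₁ where
  infixl 6 _+_
  infixl 7 _*_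
  infix 4 _≤_
  field
    R   : Set
    0#  : R
    1#  : R
    _+_ : R → R → R
    _*_ : R → R → R
    -_  : R → R
    _≤_ : R → R → Set
    isCommutativeRing : AS.IsCommutativeRing {A = R} _≡_ _+_ _*_ -_ 0# 1#
    0≢1 : ¬ (0# ≡ 1#)
    *-inverse : ∀ x → ¬ (x ≡ 0#) → Σ R λ y → x * y ≡ 1#
    isTotalOrder : IsTotalOrder _≡_ _≤_
    +-mono-≤ : ∀ {x y} z → x ≤ y → x + z ≤ y + z
    *-nonneg : ∀ {x y} → 0# ≤ x → 0# ≤ y → 0# ≤ x * y
    sup : (P : R → Set) → Σ R P → Σ R (λ u → ∀ x → P x → x ≤ u) →
          Σ R λ s → (∀ x → P x → x ≤ s) × (∀ u → (∀ x → P x → x ≤ u) → s ≤ u)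

module _ (ℝ : CompleteOrderedField) where
  open CompleteOrderedField ℝ

  fromℕ : ℕ → R
  fromℕ zero    = 0#
  fromℕ (suc k) = fromℕ k + 1#

  fromℤ : ℤ → R
  fromℤ (+ k)      = fromℕ k
  fromℤ -[1+ k ]   = - fromℕ (suc k)

  sumR : ∀ {m} → (Fin m → R) → R
  sumR {m} x = foldr _+_ 0# (map x (allFin m))

  Sorted : ∀ {m} → (Fin m → R) → Set
  Sorted {m} x = ∀ (i j : Fin m) → toℕ i ℕ.≤ toℕ j → x i ≤ x j

  InV : (m : ℕ) → (Fin m → R) → Set
  InV m x = (sumR x ≡ 0#) × Sorted x

  IsSortOf : ∀ {m} → (Fin m → R) → (Fin m → R) → Set
  IsSortOf {m} z y = Sorted y × Σ (Permutation′ m) λ σ → ∀ j → y j ≡ z (σ ⟨$⟩ʳ j)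

  shift : ∀ {m} → Fin m → (Fin m → R) → (Fin m → R)
  shift {m} i x j with j ≟ i
  ... | yes _ = x j + fromℕ m + - 1#
  ... | no  _ = x j + - 1#

  LetterAct : ∀ {m} → Fin m → (Fin m → R) → (Fin m → R) → Set
  LetterAct i x y = IsSortOf (shift i x) y

  WordAct : ∀ {m n} → Vec (Fin m) n → (Fin m → R) → (Fin m → R) → Set
  WordAct []      x y = ∀ j → x j ≡ y j
  WordAct (c ∷ w) x y = Σ _ λ z → LetterAct c x z × WordAct w z y

  InFix : ∀ {m n} → Vec (Fin m) n → (Fin m → R) → Set
  InFix {m} w x = InV m x × WordAct w x x

countBelow : ∀ {m n} → Vec (Fin m) n → ℕ → ℕ
countBelow {m} {n} p i = length (filter (λ j → toℕ (Data.Vec.lookup p j) ℕ.<? i) (allFin n))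

-- p ∈ PW_m^n :  |{j : p_j < i}| ≥ i n / m  for 1 ≤ i ≤ m   (multiplied through by m > 0)
IsPW : (m n : ℕ) → Vec (Fin m) n → Set
IsPW m n p = ∀ i → 1 ℕ.≤ i → i ℕ.≤ m → i ℕ.* n ℕ.≤ m ℕ.* countBelow p i

-- Each letter sorts x + m eᵢ − 𝟙, so a word of length n fixing x gives a permutation π of the
-- coordinates with x j + n = x (π j) + m c_j for some naturals c_j. Going once around a cycle of
-- π of length L yields L n ≡ 0 (mod m), hence q = m / d divides L. Cutting every cycle into
-- consecutive chains of length q gives d chains, and along a chain every step adds n = (n / d) d
-- modulo m; since n / d is invertible modulo q, the q values of a chain starting at a are
-- a + k d + b_k m for k = 0, …, q − 1 in some order.
module Submission where

open import Defs
open import Data.Nat using (ℕ; zero; suc; NonZero)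
open import Data.Nat.Divisibility using (_∣_)
open import Data.Fin using (Fin; toℕ)
open import Data.Fin.Permutation using (Permutation′; _⟨$⟩ʳ_; _⟨$⟩ˡ_; inverseˡ; inverseʳ)
open import Data.Product using (Σ; ∃; _×_; _,_; proj₁; proj₂)
open import Function using (Injective)
open import Function.Bundles using (_⤖_; Bijection)
open import Relation.Binary.PropositionalEquality

module Arithmetic where

  open import Data.Nat using (_+_; _*_; _∸_; _%_; _/_; _<_; ≢-nonZero; ≢-nonZero⁻¹)
  open import Data.Nat.Properties
    using (≤-antisym; +-cancelˡ-≡; *-comm; *-commutativeSemigroup; m∸n≡0⇒m≤n; m∸n≤m; ≤-<-trans; <⇒≱;
           *-distribʳ-∸; [m+n]∸[m+o]≡n∸o)
  open import Data.Nat.DivMod using (m≡m%n+[m/n]*n; m/n*n≡m; m*n/n≡m)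
  open import Data.Nat.Divisibility using (divides; ∣⇒≤; *-cancelʳ-∣)
  open import Data.Nat.GCD using (gcd; gcd[m,n]∣m; gcd[m,n]∣n; gcd[m,n]≢0)
  open import Data.Nat.Coprimality using (Coprime; coprime-divisor; coprime-/gcd)
  import Data.Integer as ℤ
  import Data.Integer.Properties as ℤ
  import Data.Integer.Tactic.RingSolver as ℤ
  open import Data.Sum using (inj₁)
  open import Relation.Nullary using (contradiction)
  open import Algebra.Properties.CommutativeSemigroup *-commutativeSemigroup using (xy∙z≈xz∙y)

  [m+n]%o≡m⇒o∣n : ∀ m n o .{{_ : NonZero o}} → (m + n) % o ≡ m → o ∣ n
  [m+n]%o≡m⇒o∣n m n o eq = divides ((m + n) / o)
    (+-cancelˡ-≡ m _ _ (trans (m≡m%n+[m/n]*n (m + n) o) (cong (_+ (m + n) / o * o) eq)))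

  m%o≡n%o⇒o∣n∸m : ∀ m n o .{{_ : NonZero o}} → m % o ≡ n % o → o ∣ n ∸ m
  m%o≡n%o⇒o∣n∸m m n o eq = divides (n / o ∸ m / o) (begin
    n ∸ m                                      ≡⟨ cong₂ _∸_ (m≡m%n+[m/n]*n n o) (m≡m%n+[m/n]*n m o) ⟩
    (n % o + n / o * o) ∸ (m % o + m / o * o)  ≡⟨ cong (λ r → (n % o + n / o * o) ∸ (r + m / o * o)) eq ⟩
    (n % o + n / o * o) ∸ (n % o + m / o * o)  ≡⟨ [m+n]∸[m+o]≡n∸o (n % o) _ _ ⟩
    n / o * o ∸ m / o * o                      ≡⟨ *-distribʳ-∸ o (n / o) (m / o) ⟨
    (n / o ∸ m / o) * o                        ∎)
    where open ≡-Reasoning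

  ∣∧<⇒≡0 : ∀ {o n} → o ∣ n → n < o → n ≡ 0
  ∣∧<⇒≡0 {n = zero}  _   _   = refl
  ∣∧<⇒≡0 {n = suc n} o∣n n<o = contradiction (∣⇒≤ o∣n) (<⇒≱ n<o)

  m∣n*o⇒m/gcd[m,n]∣o : ∀ m n o .{{_ : NonZero (gcd m n)}} → m ∣ n * o → m / gcd m n ∣ o
  m∣n*o⇒m/gcd[m,n]∣o m n o m∣no = coprime-divisor (coprime-/gcd m n)
    (*-cancelʳ-∣ (gcd m n) (subst₂ _∣_ (sym (m/n*n≡m (gcd[m,n]∣m m n))) no≡ m∣no))
    where
    open ≡-Reasoning
    no≡ : n * o ≡ n / gcd m n * o * gcd m n
    no≡ = begin
      n * o                      ≡⟨ cong (_* o) (m/n*n≡m (gcd[m,n]∣n m n)) ⟨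
      n / gcd m n * gcd m n * o  ≡⟨ xy∙z≈xz∙y (n / gcd m n) (gcd m n) o ⟩
      n / gcd m n * o * gcd m n  ∎

  [a+b*c]⊖c*e≡a+[b-e]*c : ∀ a b c e →
                          (a + b * c) ℤ.⊖ (c * e) ≡ ℤ.+ a ℤ.+ (ℤ.+ b ℤ.- ℤ.+ e) ℤ.* ℤ.+ c
  [a+b*c]⊖c*e≡a+[b-e]*c a b c e = begin
    (a + b * c) ℤ.⊖ (c * e)                              ≡⟨ ℤ.m-n≡m⊖n (a + b * c) (c * e) ⟨
    ℤ.+ (a + b * c) ℤ.- ℤ.+ (c * e)                      ≡⟨ cong₂ ℤ._-_ +[a+b*c]≡ (ℤ.pos-* c e) ⟩
    (ℤ.+ a ℤ.+ ℤ.+ b ℤ.* ℤ.+ c) ℤ.- ℤ.+ c ℤ.* ℤ.+ e      ≡⟨ regroup (ℤ.+ a) (ℤ.+ b) (ℤ.+ c) (ℤ.+ e) ⟩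
    ℤ.+ a ℤ.+ (ℤ.+ b ℤ.- ℤ.+ e) ℤ.* ℤ.+ c                ∎
    where
    open ≡-Reasoning
    +[a+b*c]≡ : ℤ.+ (a + b * c) ≡ ℤ.+ a ℤ.+ ℤ.+ b ℤ.* ℤ.+ c
    +[a+b*c]≡ = trans (ℤ.pos-+ a (b * c)) (cong (ℤ._+_ (ℤ.+ a)) (ℤ.pos-* b c))
    regroup : ∀ a b c e → (a ℤ.+ b ℤ.* c) ℤ.- c ℤ.* e ≡ a ℤ.+ (b ℤ.- e) ℤ.* c
    regroup = ℤ.solve-∀

  gcd-nonZero : ∀ m n .{{_ : NonZero m}} → NonZero (gcd m n)
  gcd-nonZero m n = ≢-nonZero (gcd[m,n]≢0 m n (inj₁ (≢-nonZero⁻¹ m)))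

  m*n≡o⇒o/n≡m : ∀ m n o .{{_ : NonZero n}} → m * n ≡ o → o / n ≡ m
  m*n≡o⇒o/n≡m m n o eq = trans (cong (_/ n) (sym eq)) (m*n/n≡m m n)

  coprime⇒*-%-∸≡0 : ∀ {q a} .{{_ : NonZero q}} → Coprime q a →
                    ∀ {t u} → u < q → (t * a) % q ≡ (u * a) % q → u ∸ t ≡ 0
  coprime⇒*-%-∸≡0 {q} {a} q⊥a {t} {u} u<q eq = ∣∧<⇒≡0
    (coprime-divisor q⊥a (subst (q ∣_) (trans (sym (*-distribʳ-∸ a u t)) (*-comm (u ∸ t) a))
      (m%o≡n%o⇒o∣n∸m (t * a) (u * a) q eq)))
    (≤-<-trans (m∸n≤m u t) u<q)

  coprime⇒*-%-injective : ∀ {q a} .{{_ : NonZero q}} → Coprime q a →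
                          ∀ {t u} → t < q → u < q → (t * a) % q ≡ (u * a) % q → t ≡ u
  coprime⇒*-%-injective q⊥a {t} {u} t<q u<q eq = ≤-antisym
    (m∸n≡0⇒m≤n (coprime⇒*-%-∸≡0 q⊥a {u} {t} t<q (sym eq)))
    (m∸n≡0⇒m≤n (coprime⇒*-%-∸≡0 q⊥a {t} {u} u<q eq))

module Iteration where

  open import Data.Nat using (_+_; _*_; _%_; _/_)
  open import Data.Nat.DivMod using (m≡m%n+[m/n]*n)

  infixr 8 _^_

  _^_ : {A : Set} → (A → A) → ℕ → A → A
  (f ^ zero)  a = a
  (f ^ suc t) a = f ((f ^ t) a)

  module _ {A : Set} (f : A → A) where

    ^-suc : ∀ t a → (f ^ suc t) a ≡ (f ^ t) (f a)
    ^-suc zero    a = refl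
    ^-suc (suc t) a = cong f (^-suc t a)

    ^-+ : ∀ s t a → (f ^ (s + t)) a ≡ (f ^ s) ((f ^ t) a)
    ^-+ zero    t a = refl
    ^-+ (suc s) t a = cong f (^-+ s t a)

    ^-*-periodic : ∀ {P a} → (f ^ P) a ≡ a → ∀ k → (f ^ (k * P)) a ≡ a
    ^-*-periodic         fᴾa≡a zero    = refl
    ^-*-periodic {P} {a} fᴾa≡a (suc k) =
      trans (^-+ P (k * P) a) (trans (cong (f ^ P) (^-*-periodic fᴾa≡a k)) fᴾa≡a)

    ^-%-periodic : ∀ {P a} .{{_ : NonZero P}} → (f ^ P) a ≡ a → ∀ u → (f ^ u) a ≡ (f ^ (u % P)) a
    ^-%-periodic {P} {a} fᴾa≡a u = begin
      (f ^ u) a                                 ≡⟨ cong (λ v → (f ^ v) a) (m≡m%n+[m/n]*n u P) ⟩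
      (f ^ (u % P + u / P * P)) a               ≡⟨ ^-+ (u % P) (u / P * P) a ⟩
      (f ^ (u % P)) ((f ^ (u / P * P)) a)       ≡⟨ cong (f ^ (u % P)) (^-*-periodic fᴾa≡a (u / P)) ⟩
      (f ^ (u % P)) a                           ∎
      where open ≡-Reasoning

  module _ {A : Set} {f g : A → A} (g∘f≗id : ∀ a → g (f a) ≡ a) where

    ^-inverseˡ : ∀ t a → (g ^ t) ((f ^ t) a) ≡ a
    ^-inverseˡ zero    a = refl
    ^-inverseˡ (suc t) a =
      trans (^-suc g t (f ((f ^ t) a))) (trans (cong (g ^ t) (g∘f≗id _)) (^-inverseˡ t a))

    ^-injective : ∀ t → Injective _≡_ _≡_ (f ^ t)
    ^-injective t {a} {b} eq = trans (sym (^-inverseˡ t a)) (trans (cong (g ^ t) eq) (^-inverseˡ t b))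

open Iteration

module FiniteSets where

  open import Data.Nat using (_*_)
  open import Data.Fin using (punchOut; zero; suc)
  open import Data.Fin.Properties using (any?; _≟_; injective⇒≤; punchOut-injective; *↔×)
  open import Data.Fin.Permutation using (↔⇒≡)
  open import Data.Nat.Properties using (1+n≰n)
  open import Data.List using (List; _∷_; lookup)
  open import Data.List.Membership.Propositional.Properties using (∈-lookup)
  open import Data.List.Relation.Unary.All as All using ()
  open import Data.List.Relation.Unary.Unique.Propositional using (Unique)
  open import Data.List.Relation.Unary.AllPairs using (_∷_)
  open import Function.Properties.Bijection using (⤖⇒↔)
  open import Function.Properties.Inverse using (↔-trans)
  open import Relation.Nullary using (¬_; yes; no; contradiction)

  injective⇒strictlySurjective : ∀ {n} {h : Fin n → Fin n} → Injective _≡_ _≡_ h →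
                                 ∀ y → ∃ λ x → h x ≡ y
  injective⇒strictlySurjective {suc n} {h} h-injective y with any? (λ x → h x ≟ y)
  ... | yes hit = hit
  ... | no  miss = contradiction (injective⇒≤ h′-injective) 1+n≰n
    where
    h≢y : ∀ x → ¬ (y ≡ h x)
    h≢y x y≡hx = miss (x , sym y≡hx)
    h′ : Fin (suc n) → Fin n
    h′ x = punchOut (h≢y x)
    h′-injective : Injective _≡_ _≡_ h′
    h′-injective eq = h-injective (punchOut-injective (h≢y _) (h≢y _) eq)

  lookup-injective : ∀ {A : Set} {xs : List A} → Unique xs → ∀ i j → lookup xs i ≡ lookup xs j → i ≡ j
  lookup-injective (_     ∷ _) zero    zero    _  = refl
  lookup-injective (x∉xs ∷ _) zero    (suc j) eq = contradiction eq (All.lookup x∉xs (∈-lookup j))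
  lookup-injective (x∉xs ∷ _) (suc i) zero    eq = contradiction (sym eq) (All.lookup x∉xs (∈-lookup i))
  lookup-injective (_     ∷ u) (suc i) (suc j) eq = cong suc (lookup-injective u i j eq)

  ×⤖⇒*≡ : ∀ {a b c} → (Fin a × Fin b) ⤖ Fin c → a * b ≡ c
  ×⤖⇒*≡ β = ↔⇒≡ (↔-trans *↔× (⤖⇒↔ β))

open FiniteSets

module Orbits {m : ℕ} (π : Permutation′ m) where

  open import Data.Nat using (_+_; _%_; _≤_; _<_; s≤s)
  open import Data.Nat.Properties using (≤-antisym; n<1+n; m≤n⇒∃[o]m+o≡n; +-suc; m≤n+m; ≤-trans; <-≤-trans; ≤-pred; ≤-reflexive)
  open import Data.Nat.DivMod using (m%n<n)
  open import Data.Fin.Properties using (toℕ-injective; toℕ<n; pigeonhole)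
  open import Data.List using (upTo)
  open import Data.List.Extrema.Nat using (argmin; f[argmin]≤f[xs])
  open import Data.List.Membership.Propositional.Properties using (∈-upTo⁺)
  open import Data.List.Relation.Unary.All as All using ()

  private
    f g : Fin m → Fin m
    f = π ⟨$⟩ʳ_
    g = π ⟨$⟩ˡ_

  backward-period : ∀ i → ∃ λ P → P < m × (g ^ suc P) i ≡ i
  backward-period i with u , v , u<v , gᵘi≡gᵛi ← pigeonhole (n<1+n m) (λ u → (g ^ toℕ u) i)
                      with P , u+P≡v ← m≤n⇒∃[o]m+o≡n u<v =
    P , P<m , ^-injective {g = f} (λ _ → inverseʳ π) (toℕ u) (begin
      (g ^ toℕ u) ((g ^ suc P) i)  ≡⟨ ^-+ g (toℕ u) (suc P) i ⟨
      (g ^ (toℕ u + suc P)) i      ≡⟨ cong (λ w → (g ^ w) i) (trans (+-suc (toℕ u) P) u+P≡v) ⟩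
      (g ^ toℕ v) i                ≡⟨ gᵘi≡gᵛi ⟨
      (g ^ toℕ u) i                ∎)
    where
    open ≡-Reasoning
    P<m : P < m
    P<m = ≤-trans (s≤s (m≤n+m P (toℕ u))) (≤-trans (≤-reflexive u+P≡v) (≤-pred (toℕ<n v)))

  pos : Fin m → ℕ
  pos i = argmin (λ u → toℕ ((g ^ u) i)) 0 (upTo m)

  rep : Fin m → Fin m
  rep i = (g ^ pos i) i

  rep-minimal : ∀ i u → toℕ (rep i) ≤ toℕ ((g ^ u) i)
  rep-minimal i u with P , P<m , gᴾi≡i ← backward-period i =
    subst (λ y → toℕ (rep i) ≤ toℕ y) (sym (^-%-periodic g gᴾi≡i u))
      (All.lookup (f[argmin]≤f[xs] {f = λ u → toℕ ((g ^ u) i)} 0 (upTo m))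
                  (∈-upTo⁺ (<-≤-trans (m%n<n u (suc P)) P<m)))

  rep-reaches : ∀ i → (f ^ pos i) (rep i) ≡ i
  rep-reaches i = ^-inverseˡ {f = g} {g = f} (λ _ → inverseʳ π) (pos i) i

  rep-forward : ∀ i → rep (f i) ≡ rep i
  rep-forward i with P , _ , gᴾ⁺¹i≡i ← backward-period i =
    toℕ-injective (≤-antisym rep[fi]≤rep[i] rep[i]≤rep[fi])
    where
    gᴾi≡fi : (g ^ P) i ≡ f i
    gᴾi≡fi = trans (sym (inverseʳ π)) (cong f gᴾ⁺¹i≡i)
    rep[fi]≤rep[i] : toℕ (rep (f i)) ≤ toℕ (rep i)
    rep[fi]≤rep[i] = subst (λ y → toℕ (rep (f i)) ≤ toℕ y)
      (trans (^-suc g (pos i) (f i)) (cong (g ^ pos i) (inverseˡ π)))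
      (rep-minimal (f i) (suc (pos i)))
    rep[i]≤rep[fi] : toℕ (rep i) ≤ toℕ (rep (f i))
    rep[i]≤rep[fi] = subst (λ y → toℕ (rep i) ≤ toℕ y)
      (trans (^-+ g (pos (f i)) P i) (cong (g ^ pos (f i)) gᴾi≡fi))
      (rep-minimal i (pos (f i) + P))

  rep-^ : ∀ t i → rep ((f ^ t) i) ≡ rep i
  rep-^ zero    i = refl
  rep-^ (suc t) i = trans (rep-forward ((f ^ t) i)) (rep-^ t i)

module Chains {m : ℕ} (π : Permutation′ m) (q : ℕ) .{{_ : NonZero q}}
              (q∣cycle-length : ∀ i t → ((π ⟨$⟩ʳ_) ^ t) i ≡ i → q ∣ t) where

  open import Data.Nat using (_+_; _%_; _≤_)
  open import Data.Nat.Properties using (≤-total; m≤n⇒∃[o]m+o≡n)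
  open import Data.Nat.DivMod using (m%n<n; m<n⇒m%n≡m; %-remove-+ʳ)
  open import Data.Nat.Divisibility using (_∣?_)
  open import Data.Fin using (fromℕ<)
  open import Data.Fin.Properties using (toℕ-injective; toℕ<n; toℕ-fromℕ<)
  open import Data.List using (List; length; lookup; filter; allFin)
  open import Data.List.Membership.Propositional using (_∈_)
  open import Data.List.Membership.Propositional.Properties using (∈-allFin; ∈-filter⁺; ∈-filter⁻; ∈-lookup)
  open import Data.List.Relation.Unary.Any as Any using ()
  open import Data.List.Relation.Unary.Any.Properties using (lookup-index)
  open import Data.List.Relation.Unary.Unique.Propositional using (Unique)
  import Data.List.Relation.Unary.Unique.Propositional.Properties as Unique
  open import Data.Sum using (inj₁; inj₂)
  open import Function.Bundles using (mk⤖)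
  open import Function.Consequences.Propositional using (strictlySurjective⇒surjective)
  open Arithmetic using ([m+n]%o≡m⇒o∣n)
  open Orbits π
  open ≡-Reasoning

  private
    f g : Fin m → Fin m
    f = π ⟨$⟩ʳ_
    g = π ⟨$⟩ˡ_

  ≤∧^-≡⇒%-≡ : ∀ {u v r} → u ≤ v → (f ^ u) r ≡ (f ^ v) r → u % q ≡ v % q
  ≤∧^-≡⇒%-≡ {u} {r = r} u≤v eq with k , refl ← m≤n⇒∃[o]m+o≡n u≤v =
    sym (%-remove-+ʳ u (q∣cycle-length r k
      (sym (^-injective {g = g} (λ _ → inverseˡ π) u (trans eq (^-+ f u k r))))))

  ^-≡⇒%-≡ : ∀ {u v r} → (f ^ u) r ≡ (f ^ v) r → u % q ≡ v % q
  ^-≡⇒%-≡ {u} {v} eq with ≤-total u v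
  ... | inj₁ u≤v = ≤∧^-≡⇒%-≡ u≤v eq
  ... | inj₂ v≤u = sym (≤∧^-≡⇒%-≡ v≤u (sym eq))

  pos-^ : ∀ t i → pos ((f ^ t) i) % q ≡ (t + pos i) % q
  pos-^ t i = ^-≡⇒%-≡ (begin
    (f ^ pos ((f ^ t) i)) (rep i)            ≡⟨ cong (f ^ pos ((f ^ t) i)) (rep-^ t i) ⟨
    (f ^ pos ((f ^ t) i)) (rep ((f ^ t) i))  ≡⟨ rep-reaches ((f ^ t) i) ⟩
    (f ^ t) i                                ≡⟨ cong (f ^ t) (rep-reaches i) ⟨
    (f ^ t) ((f ^ pos i) (rep i))            ≡⟨ ^-+ f t (pos i) (rep i) ⟨
    (f ^ (t + pos i)) (rep i)                ∎)

  starts : List (Fin m)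
  starts = filter (λ b → q ∣? pos b) (allFin m)

  starts-unique : Unique starts
  starts-unique = Unique.filter⁺ (λ b → q ∣? pos b) (Unique.allFin⁺ m)

  q∣pos-start : ∀ j → q ∣ pos (lookup starts j)
  q∣pos-start j = proj₂ (∈-filter⁻ (λ b → q ∣? pos b) {xs = allFin m} (∈-lookup j))

  chain : Fin (length starts) × Fin q → Fin m
  chain (j , t) = (f ^ toℕ t) (lookup starts j)

  pos-chain : ∀ j t → pos (chain (j , t)) % q ≡ toℕ t
  pos-chain j t = begin
    pos (chain (j , t)) % q              ≡⟨ pos-^ (toℕ t) (lookup starts j) ⟩
    (toℕ t + pos (lookup starts j)) % q  ≡⟨ %-remove-+ʳ (toℕ t) (q∣pos-start j) ⟩
    toℕ t % q                            ≡⟨ m<n⇒m%n≡m (toℕ<n t) ⟩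
    toℕ t                                ∎

  chain-injective : Injective _≡_ _≡_ chain
  chain-injective {j , t} {j′ , t′} eq = cong₂ _,_ j≡j′ t≡t′
    where
    t≡t′ : t ≡ t′
    t≡t′ = toℕ-injective (trans (sym (pos-chain j t)) (trans (cong (λ y → pos y % q) eq) (pos-chain j′ t′)))
    j≡j′ : j ≡ j′
    j≡j′ = lookup-injective starts-unique j j′ (^-injective {g = g} (λ _ → inverseˡ π) (toℕ t)
      (trans eq (cong (λ s → chain (j′ , s)) (sym t≡t′))))

  chain-strictlySurjective : ∀ y → ∃ λ jt → chain jt ≡ y
  chain-strictlySurjective y = (Any.index b∈starts , t) , (begin
    (f ^ toℕ t) (lookup starts (Any.index b∈starts))  ≡⟨ cong (f ^ toℕ t) (lookup-index b∈starts) ⟨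
    (f ^ toℕ t) b                                     ≡⟨ fᵗb≡y ⟩
    y                                                 ∎)
    where
    t : Fin q
    t = fromℕ< (m%n<n (pos y) q)
    b : Fin m
    b = (g ^ toℕ t) y
    fᵗb≡y : (f ^ toℕ t) b ≡ y
    fᵗb≡y = ^-inverseˡ {f = g} {g = f} (λ _ → inverseʳ π) (toℕ t) y
    q∣pos-b : q ∣ pos b
    q∣pos-b = [m+n]%o≡m⇒o∣n (toℕ t) (pos b) q (begin
      (toℕ t + pos b) % q      ≡⟨ pos-^ (toℕ t) b ⟨
      pos ((f ^ toℕ t) b) % q  ≡⟨ cong (λ z → pos z % q) fᵗb≡y ⟩
      pos y % q                ≡⟨ toℕ-fromℕ< (m%n<n (pos y) q) ⟨
      toℕ t                    ∎)
    b∈starts : b ∈ starts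
    b∈starts = ∈-filter⁺ (λ b → q ∣? pos b) (∈-allFin b) q∣pos-b

  chain-bijection : (Fin (length starts) × Fin q) ⤖ Fin m
  chain-bijection = mk⤖ (chain-injective , strictlySurjective⇒surjective chain-strictlySurjective)

module OrderedFieldProperties (ℝ : CompleteOrderedField) where

  open import Level using (0ℓ)
  import Data.Nat as ℕ
  open import Data.Integer using (_⊖_)
  open import Data.Integer.Properties using ([1+m]⊖[1+n]≡m⊖n)
  open import Data.Sum using (inj₁; inj₂)
  open import Relation.Nullary using (¬_; contradiction)
  open import Relation.Binary.Structures using (IsTotalOrder)
  open import Algebra.Bundles using (CommutativeRing)
  import Algebra.Properties.Group as GroupProperties
  import Algebra.Properties.Ring as RingProperties
  import Algebra.Properties.CommutativeSemigroup as CommutativeSemigroupProperties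
  open CompleteOrderedField ℝ
  open IsTotalOrder isTotalOrder using (total; antisym; reflexive) renaming (trans to ≤-trans)
  open ≡-Reasoning

  commutativeRing : CommutativeRing 0ℓ 0ℓ
  commutativeRing = record { isCommutativeRing = isCommutativeRing }

  open CommutativeRing commutativeRing using (-‿inverseˡ; -‿inverseʳ; +-group; +-commutativeSemigroup; ring)
  open CommutativeRing commutativeRing public using (+-assoc; +-identityˡ; +-identityʳ)
  open GroupProperties +-group using (⁻¹-involutive)
  open GroupProperties +-group public using (∙-cancelˡ; ∙-cancelʳ; //-rightDividesˡ)
  open RingProperties ring using (-1*x≈-x)
  open CommutativeSemigroupProperties +-commutativeSemigroup public using (xy∙z≈xz∙y; x∙yz≈xz∙y)

  0≤1 : 0# ≤ 1#
  0≤1 with total 0# 1#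
  ... | inj₁ 0≤1 = 0≤1
  ... | inj₂ 1≤0 = subst (0# ≤_) (trans (-1*x≈-x (- 1#)) (⁻¹-involutive 1#)) (*-nonneg 0≤-1 0≤-1)
    where
    0≤-1 : 0# ≤ - 1#
    0≤-1 = subst₂ _≤_ (-‿inverseʳ 1#) (+-identityˡ (- 1#)) (+-mono-≤ (- 1#) 1≤0)

  0≤fromℕ : ∀ k → 0# ≤ fromℕ ℝ k
  0≤fromℕ zero    = reflexive refl
  0≤fromℕ (suc k) = ≤-trans 0≤1 (subst (_≤ fromℕ ℝ k + 1#) (+-identityˡ 1#) (+-mono-≤ 1# (0≤fromℕ k)))

  fromℕ-suc≢0 : ∀ k → ¬ (fromℕ ℝ (suc k) ≡ 0#)
  fromℕ-suc≢0 k eq = 0≢1 (antisym 0≤1 1≤0)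
    where
    1≤0 : 1# ≤ 0#
    1≤0 = subst₂ _≤_ (+-identityˡ 1#) eq (+-mono-≤ 1# (0≤fromℕ k))

  fromℕ-injective : ∀ a b → fromℕ ℝ a ≡ fromℕ ℝ b → a ≡ b
  fromℕ-injective zero    zero    _  = refl
  fromℕ-injective zero    (suc b) eq = contradiction (sym eq) (fromℕ-suc≢0 b)
  fromℕ-injective (suc a) zero    eq = contradiction eq (fromℕ-suc≢0 a)
  fromℕ-injective (suc a) (suc b) eq = cong suc (fromℕ-injective a b (∙-cancelʳ 1# _ _ eq))

  fromℕ-+ : ∀ a b → fromℕ ℝ (a ℕ.+ b) ≡ fromℕ ℝ a + fromℕ ℝ b
  fromℕ-+ zero    b = sym (+-identityˡ _)
  fromℕ-+ (suc a) b = begin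
    fromℕ ℝ (a ℕ.+ b) + 1#            ≡⟨ cong (_+ 1#) (fromℕ-+ a b) ⟩
    (fromℕ ℝ a + fromℕ ℝ b) + 1#      ≡⟨ xy∙z≈xz∙y _ _ _ ⟩
    (fromℕ ℝ a + 1#) + fromℕ ℝ b      ∎

  fromℤ-⊖ : ∀ a b → fromℤ ℝ (a ⊖ b) + fromℕ ℝ b ≡ fromℕ ℝ a
  fromℤ-⊖ a       zero    = +-identityʳ _
  fromℤ-⊖ zero    (suc b) = -‿inverseˡ _
  fromℤ-⊖ (suc a) (suc b) = begin
    fromℤ ℝ (suc a ⊖ suc b) + (fromℕ ℝ b + 1#)  ≡⟨ cong (λ z → fromℤ ℝ z + (fromℕ ℝ b + 1#)) ([1+m]⊖[1+n]≡m⊖n a b) ⟩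
    fromℤ ℝ (a ⊖ b) + (fromℕ ℝ b + 1#)          ≡⟨ +-assoc _ _ _ ⟨
    (fromℤ ℝ (a ⊖ b) + fromℕ ℝ b) + 1#          ≡⟨ cong (_+ 1#) (fromℤ-⊖ a b) ⟩
    fromℕ ℝ a + 1#                              ∎

  x+c≡y+a⇒x≡y+a⊖c : ∀ {x y} a c → x + fromℕ ℝ c ≡ y + fromℕ ℝ a → x ≡ y + fromℤ ℝ (a ⊖ c)
  x+c≡y+a⇒x≡y+a⊖c {x} {y} a c eq = ∙-cancelʳ (fromℕ ℝ c) _ _ (begin
    x + fromℕ ℝ c                         ≡⟨ eq ⟩
    y + fromℕ ℝ a                         ≡⟨ cong (y +_) (fromℤ-⊖ a c) ⟨
    y + (fromℤ ℝ (a ⊖ c) + fromℕ ℝ c)     ≡⟨ +-assoc _ _ _ ⟨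
    (y + fromℤ ℝ (a ⊖ c)) + fromℕ ℝ c     ∎)

module Rearrangements (ℝ : CompleteOrderedField) {m : ℕ} where

  open import Data.Nat as ℕ using (_*_)
  open import Data.Nat.Properties using (*-zeroʳ; *-identityʳ; *-distribˡ-+)
  open import Data.Fin using (_≟_)
  open import Data.Fin.Permutation as Permutation using (_∘ₚ_)
  open import Data.Vec using (Vec; []; _∷_)
  open import Function using (id; _∘_)
  open import Relation.Nullary using (yes; no)
  open CompleteOrderedField ℝ using (R; _+_; 1#)
  open OrderedFieldProperties ℝ
  open ≡-Reasoning

  record Rearrangement (σ : Fin m → Fin m) (k : ℕ) (x y : Fin m → R) : Set where
    constructor rearrangement
    field
      congruent : ∀ j → ∃ λ c → y j + fromℕ ℝ k ≡ x (σ j) + fromℕ ℝ (m * c)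

  open Rearrangement public

  rearrangement-id : ∀ {x y} → (∀ j → x j ≡ y j) → Rearrangement id 0 x y
  rearrangement-id x≗y = rearrangement λ j → 0 , cong₂ _+_ (sym (x≗y j)) (cong (fromℕ ℝ) (sym (*-zeroʳ m)))

  rearrangement-∘ : ∀ {σ τ k l x y z} → Rearrangement σ k x z → Rearrangement τ l z y →
                    Rearrangement (σ ∘ τ) (k ℕ.+ l) x y
  rearrangement-∘ {σ} {τ} {k} {l} {x} {y} {z} x→z z→y = rearrangement λ j → composite j
    where
    composite : ∀ j → ∃ λ c → y j + fromℕ ℝ (k ℕ.+ l) ≡ x (σ (τ j)) + fromℕ ℝ (m * c)
    composite j with c₂ , e₂ ← congruent z→y j | c₁ , e₁ ← congruent x→z (τ j) = c₁ ℕ.+ c₂ , (begin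
      y j + fromℕ ℝ (k ℕ.+ l)                                ≡⟨ cong (y j +_) (fromℕ-+ k l) ⟩
      y j + (fromℕ ℝ k + fromℕ ℝ l)                          ≡⟨ x∙yz≈xz∙y _ _ _ ⟩
      (y j + fromℕ ℝ l) + fromℕ ℝ k                          ≡⟨ cong (_+ fromℕ ℝ k) e₂ ⟩
      (z (τ j) + fromℕ ℝ (m * c₂)) + fromℕ ℝ k               ≡⟨ xy∙z≈xz∙y _ _ _ ⟩
      (z (τ j) + fromℕ ℝ k) + fromℕ ℝ (m * c₂)               ≡⟨ cong (_+ fromℕ ℝ (m * c₂)) e₁ ⟩
      (x (σ (τ j)) + fromℕ ℝ (m * c₁)) + fromℕ ℝ (m * c₂)    ≡⟨ +-assoc _ _ _ ⟩
      x (σ (τ j)) + (fromℕ ℝ (m * c₁) + fromℕ ℝ (m * c₂))    ≡⟨ cong (x (σ (τ j)) +_) (fromℕ-+ (m * c₁) (m * c₂)) ⟨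
      x (σ (τ j)) + fromℕ ℝ (m * c₁ ℕ.+ m * c₂)              ≡⟨ cong (λ c → x (σ (τ j)) + fromℕ ℝ c) (*-distribˡ-+ m c₁ c₂) ⟨
      x (σ (τ j)) + fromℕ ℝ (m * (c₁ ℕ.+ c₂))                ∎)

  rearrangement-^ : ∀ {σ k x} → Rearrangement σ k x x → ∀ t → Rearrangement (σ ^ t) (t * k) x x
  rearrangement-^ x→x zero    = rearrangement-id (λ _ → refl)
  rearrangement-^ x→x (suc t) = rearrangement-∘ x→x (rearrangement-^ x→x t)

  shift+1 : ∀ (c : Fin m) (x : Fin m → R) i → ∃ λ δ → shift ℝ c x i + 1# ≡ x i + fromℕ ℝ (m * δ)
  shift+1 c x i with i ≟ c
  ... | yes _ = 1 , trans (//-rightDividesˡ 1# _) (cong (λ k → x i + fromℕ ℝ k) (sym (*-identityʳ m)))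
  ... | no  _ = 0 , trans (//-rightDividesˡ 1# _)
                    (trans (sym (+-identityʳ (x i))) (cong (λ k → x i + fromℕ ℝ k) (sym (*-zeroʳ m))))

  letterAct⇒rearrangement : ∀ {c x z} → LetterAct ℝ c x z →
                            Σ (Permutation′ m) λ σ → Rearrangement (σ ⟨$⟩ʳ_) 1 x z
  letterAct⇒rearrangement {c} {x} {z} (_ , σ , z≗shift) = σ , rearrangement λ j →
    let δ , e = shift+1 c x (σ ⟨$⟩ʳ j) in δ , trans (cong₂ _+_ (z≗shift j) (+-identityˡ 1#)) e

  wordAct⇒rearrangement : ∀ {k} (w : Vec (Fin m) k) {x y} → WordAct ℝ w x y →
                          Σ (Permutation′ m) λ π → Rearrangement (π ⟨$⟩ʳ_) k x y
  wordAct⇒rearrangement []      x≗y = Permutation.id , rearrangement-id x≗y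
  wordAct⇒rearrangement (c ∷ w) (_ , x→z , z→y)
    with σ , x↝z ← letterAct⇒rearrangement x→z | π , z↝y ← wordAct⇒rearrangement w z→y =
    π ∘ₚ σ , rearrangement-∘ x↝z z↝y

module FixedPoint (ℝ : CompleteOrderedField) {m n : ℕ} .{{_ : NonZero m}}
                  (x : Fin m → CompleteOrderedField.R ℝ) (π : Permutation′ m)
                  (x↝x : Rearrangements.Rearrangement ℝ (π ⟨$⟩ʳ_) n x x) where

  import Data.Nat as ℕ
  open import Data.Nat using (_*_; _%_; _/_; ≢-nonZero)
  open import Data.Nat.Properties using (*-cancelʳ-≡; *-comm; *-assoc; *-distribʳ-+)
  open import Data.Nat.DivMod using (m≡m%n+[m/n]*n; m%n<n; m/n*n≡m)
  open import Data.Nat.Divisibility using (divides)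
  open import Data.Nat.GCD using (gcd; gcd[m,n]∣m; gcd[m,n]∣n; m/gcd[m,n]≢0)
  open import Data.Nat.Coprimality using (coprime-/gcd)
  open import Data.Integer as ℤ using (ℤ; +_; _⊖_)
  open import Data.Fin using (fromℕ<)
  open import Data.Fin.Properties using (toℕ-injective; toℕ<n; toℕ-fromℕ<)
  open import Data.List using (length; lookup)
  open import Data.Product.Function.NonDependent.Propositional using (_×-⤖_)
  open import Function.Bundles using (mk⤖)
  open import Function.Consequences.Propositional using (strictlySurjective⇒surjective)
  import Function.Properties.Bijection as Bijection
  open CompleteOrderedField ℝ using (R; _+_)
  open OrderedFieldProperties ℝ
  open Rearrangements ℝ
  open Arithmetic
  open ≡-Reasoning

  d : ℕ
  d = gcd m n

  instance
    d≢0 : NonZero d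
    d≢0 = gcd-nonZero m n

  q n′ : ℕ
  q  = m / d
  n′ = n / d

  instance
    q≢0 : NonZero q
    q≢0 = ≢-nonZero (m/gcd[m,n]≢0 m n)

  private
    f : Fin m → Fin m
    f = π ⟨$⟩ʳ_

  q∣cycle-length : ∀ i t → (f ^ t) i ≡ i → q ∣ t
  q∣cycle-length i t fᵗi≡i with C , e ← congruent (rearrangement-^ x↝x t) i =
    m∣n*o⇒m/gcd[m,n]∣o m n t (divides C (begin
      n * t  ≡⟨ *-comm n t ⟩
      t * n  ≡⟨ fromℕ-injective _ _ (∙-cancelˡ (x i) _ _ (trans e (cong (λ j → x j + fromℕ ℝ (m * C)) fᵗi≡i))) ⟩
      m * C  ≡⟨ *-comm m C ⟩
      C * m  ∎))

  open Chains π q q∣cycle-length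

  starts-length : length starts ≡ d
  starts-length = *-cancelʳ-≡ _ _ q (begin
    length starts * q  ≡⟨ ×⤖⇒*≡ chain-bijection ⟩
    m                  ≡⟨ m/n*n≡m (gcd[m,n]∣m m n) ⟨
    q * d              ≡⟨ *-comm q d ⟩
    d * q              ∎)

  -- Each step along π adds n = n′ * d modulo m, so the t-th element of a chain sits at offset
  -- (t * n′ mod q) * d; as q and n′ are coprime, this relabels the positions of a chain bijectively.
  label : Fin q → Fin q
  label t = fromℕ< (m%n<n (toℕ t * n′) q)

  label-injective : Injective _≡_ _≡_ label
  label-injective {t} {u} eq = toℕ-injective (coprime⇒*-%-injective (coprime-/gcd m n) (toℕ<n t) (toℕ<n u)
    (trans (sym (toℕ-fromℕ< _)) (trans (cong toℕ eq) (toℕ-fromℕ< _))))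

  unlabel : Fin q ⤖ Fin q
  unlabel = Bijection.sym-≡ (mk⤖ (label-injective , strictlySurjective⇒surjective (injective⇒strictlySurjective label-injective)))

  label-unlabel : ∀ k → label (Bijection.to unlabel k) ≡ k
  label-unlabel k = proj₂ (injective⇒strictlySurjective label-injective k)

  t*n≡label*d+[t*n′/q]*m : ∀ t → toℕ t * n ≡ toℕ (label t) * d ℕ.+ (toℕ t * n′ / q) * m
  t*n≡label*d+[t*n′/q]*m t = begin
    toℕ t * n                                ≡⟨ cong (toℕ t *_) (m/n*n≡m (gcd[m,n]∣n m n)) ⟨
    toℕ t * (n / d * d)                      ≡⟨ *-assoc (toℕ t) n′ d ⟨
    toℕ t * n′ * d                      ≡⟨ cong (_* d) (m≡m%n+[m/n]*n (toℕ t * n′) q) ⟩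
    (toℕ t * n′ % q ℕ.+ W * q) * d      ≡⟨ cong (λ r → (r ℕ.+ W * q) * d) (toℕ-fromℕ< (m%n<n (toℕ t * n′) q)) ⟨
    (L ℕ.+ W * q) * d                        ≡⟨ *-distribʳ-+ d L (W * q) ⟩
    L * d ℕ.+ W * q * d                      ≡⟨ cong (L * d ℕ.+_) (*-assoc W q d) ⟩
    L * d ℕ.+ W * (q * d)                    ≡⟨ cong (λ r → L * d ℕ.+ W * r) (m/n*n≡m (gcd[m,n]∣m m n)) ⟩
    L * d ℕ.+ W * m                          ∎
    where
    L W : ℕ
    L = toℕ (label t)
    W = toℕ t * n′ / q

  x-along-orbit : ∀ b t → ∃ λ z → x ((f ^ toℕ t) b) ≡ x b + fromℤ ℝ (+ (toℕ (label t) * d) ℤ.+ z ℤ.* + m)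
  x-along-orbit b t with C , e ← congruent (rearrangement-^ x↝x (toℕ t)) b =
    + W ℤ.- + C , (begin
      x ((f ^ toℕ t) b)                                   ≡⟨ x+c≡y+a⇒x≡y+a⊖c (toℕ t * n) (m * C) (sym e) ⟩
      x b + fromℤ ℝ (toℕ t * n ⊖ m * C)                   ≡⟨ cong (λ z → x b + fromℤ ℝ (z ⊖ m * C)) (t*n≡label*d+[t*n′/q]*m t) ⟩
      x b + fromℤ ℝ ((L * d ℕ.+ W * m) ⊖ m * C)           ≡⟨ cong (λ z → x b + fromℤ ℝ z) ([a+b*c]⊖c*e≡a+[b-e]*c (L * d) W m C) ⟩
      x b + fromℤ ℝ (+ (L * d) ℤ.+ (+ W ℤ.- + C) ℤ.* + m) ∎)
    where
    L W : ℕ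
    L = toℕ (label t)
    W = toℕ t * n′ / q

  Decomposition : ℕ → Set
  Decomposition D = Σ (Fin D → R) λ a → Σ (Fin D → Fin q → ℤ) λ b →
    Σ ((Fin D × Fin q) ⤖ Fin m) λ β → ∀ j k →
      x (Bijection.to β (j , k)) ≡ a j + fromℤ ℝ (+ (toℕ k * d) ℤ.+ b j k ℤ.* + m)

  x-along-chain : ∀ j k → ∃ λ z →
    x (chain (j , Bijection.to unlabel k)) ≡ x (lookup starts j) + fromℤ ℝ (+ (toℕ k * d) ℤ.+ z ℤ.* + m)
  x-along-chain j k = z , subst (λ l → x (chain (j , t)) ≡ x b + fromℤ ℝ (+ (toℕ l * d) ℤ.+ z ℤ.* + m))
                                (label-unlabel k) (proj₂ (x-along-orbit b t))
    where
    b : Fin m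
    b = lookup starts j
    t : Fin q
    t = Bijection.to unlabel k
    z : ℤ
    z = proj₁ (x-along-orbit b t)

  decomposition : Decomposition d
  decomposition = subst Decomposition starts-length
    ( (λ j → x (lookup starts j))
    , (λ j k → proj₁ (x-along-chain j k))
    , Bijection.trans (Bijection.refl ×-⤖ unlabel) chain-bijection
    , (λ j k → proj₂ (x-along-chain j k)) )

open import Data.Nat using (_*_; _≤_)
open import Data.Nat.GCD using (gcd)
open import Data.Integer as ℤ using (ℤ; +_)
open import Data.Vec using (Vec)
open Arithmetic using (gcd-nonZero; m*n≡o⇒o/n≡m)
open CompleteOrderedField using (R; _+_)

lemma2p5 : (ℝ : CompleteOrderedField) (m n d q : ℕ) → 1 ≤ m → 1 ≤ n →
    gcd m n ≡ d → q * d ≡ m →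
    (p : Vec (Fin m) n) → IsPW m n p →
    (x : Fin m → R ℝ) → InFix ℝ p x →
    Σ (Fin d → R ℝ) λ a → Σ (Fin d → Fin q → ℤ) λ b →
      Σ ((Fin d × Fin q) ⤖ Fin m) λ π →
        ∀ (j : Fin d) (k : Fin q) →
          x (Bijection.to π (j , k))
            ≡ _+_ ℝ (a j) (fromℤ ℝ (+ (toℕ k * d) ℤ.+ b j k ℤ.* + m))
lemma2p5 ℝ (suc m) n _ q _ _ refl qd≡m p _ x (_ , p-fixes-x)
  with π , x↝x ← Rearrangements.wordAct⇒rearrangement ℝ p p-fixes-x
  with refl ← m*n≡o⇒o/n≡m q (gcd (suc m) n) (suc m) {{gcd-nonZero (suc m) n}} qd≡m =
  FixedPoint.decomposition ℝ x π x↝x
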